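{- Let $\eta\in\Pi_c^L$ be a valid Wang tiling with $\eta_1=T_A$. Then: - $\eta_{a^n}=T_A$ for all $n\in\mathbb Z$; - $\eta_{a^nb^m}=T_b$ for all $n\in\mathbb Z$, $m\ge1$; - $\eta_{a^nb^{ -m}}=T_d$ for all $n\in\mathbb Z$, $m\ge1$; - $\eta_{a^nb^ma^{ -k}}=T_s$ for all $n\in\mathbb Z$, $1\le k<m$; - $\eta_{a^nb^{ -m}a^{ -k}}=T_r$ for all $n\in\mathbb Z$, $k,m\ge1$; - $\eta_{a^nb^ma^k}=T_t$ for all $n\in\mathbb Z$, $k,m\ge1$. Conversely, these formulas, together with $\eta_g=T_t$ for all $g\notin Z=\{a^nb^ma^k: k,m,n\in\mathbb Z\}$, define a valid Wang tiling of $L$.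
   Context: **The group.** $L$ is the lamplighter group $\mathbb Z/2\wr\mathbb Z=\langle a,b\mid (a^nb^{ -n})^2\ (n\ge1)\rangle$. **Wang tiles.** A Wang tile is a $4$-tuple of colours for the sides $(a,b,a^{ -1},b^{ -1})$, in that order. A tiling $\eta\colon L\to\Pi$ is valid if, for all $g\in L$, the $a$-colour of $\eta_g$ equals the $a^{ -1}$-colour of $\eta_{ga}$, and the $b$-colour of $\eta_g$ equals the $b^{ -1}$-colour of $\eta_{gb}$. The comb tileset $\Pi_c$ consists of - $T_A=(a,b,a,d)$, - $T_t=(t,o,t,o)$, - $T_b=(t,b,s,b)$, - $T_s=(s,o,s,o)$, - $T_d=(s,d,r,d)$, - $T_r=(r,o,r,o)$, over the colours $\{a,b,d,o,r,s,t\}$. -}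

module Defs where

open import Data.Bool using (Bool; true; false; _xor_; if_then_else_)
open import Data.Integer using (ℤ; +_; -[1+_]; _+_; _-_; -_)
import Data.Integer as ℤ
open import Data.Nat using (ℕ; zero; suc; _≤_; _<_)
open import Data.List using (List; []; _∷_; _++_; map; foldr)
open import Data.Product using (Σ; _×_; _,_; ∃-syntax)
open import Relation.Nullary using (¬_; does)
open import Relation.Binary.PropositionalEquality using (_≡_)

-- The lamplighter group L = Z/2 ≀ Z, as a setoid.
-- An element is (c , x): c is a finite list of lamp toggles (a lamp at
-- position i is on iff i occurs an odd number of times in c), x is the
-- lamplighter position.

record L : Set where
  constructor ⟨_,_⟩
  field
    cfg : List ℤ
    pos : ℤ
open L public

lamp : List ℤ → ℤ → Bool
lamp c i = foldr (λ j acc → does (j ℤ.≟ i) xor acc) false c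

_≈_ : L → L → Set
g ≈ h = (pos g ≡ pos h) × (∀ i → lamp (cfg g) i ≡ lamp (cfg h) i)

_·_ : L → L → L
⟨ c , x ⟩ · ⟨ d , y ⟩ = ⟨ c ++ map (λ i → x + i) d , x + y ⟩

e : L
e = ⟨ [] , + 0 ⟩

inv : L → L
inv ⟨ c , x ⟩ = ⟨ map (λ i → i - x) c , - x ⟩

-- generators: a = shift, b = toggle lamp 0 then shift.
-- These satisfy (a^n b^{-n})^2 = 1 and generate Z/2 ≀ Z, matching the
-- presentation ⟨a,b | (a^n b^{-n})^2 (n ≥ 1)⟩.
a : L
a = ⟨ [] , + 1 ⟩

b : L
b = ⟨ + 0 ∷ [] , + 1 ⟩

npow : L → ℕ → L
npow g zero    = e
npow g (suc n) = g · npow g n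

_^_ : L → ℤ → L
g ^ (+ n)     = npow g n
g ^ -[1+ n ]  = npow (inv g) (suc n)

data Colour : Set where
  ca cb cd co cr cs ct : Colour

data Πc : Set where
  TA Tt Tb Ts Td Tr : Πc

col-a col-b col-a⁻ col-b⁻ : Πc → Colour
col-a TA = ca
col-a Tt = ct
col-a Tb = ct
col-a Ts = cs
col-a Td = cs
col-a Tr = cr
col-b TA = cb
col-b Tt = co
col-b Tb = cb
col-b Ts = co
col-b Td = cd
col-b Tr = co
col-a⁻ TA = ca
col-a⁻ Tt = ct
col-a⁻ Tb = cs
col-a⁻ Ts = cs
col-a⁻ Td = cr
col-a⁻ Tr = cr
col-b⁻ TA = cd
col-b⁻ Tt = co
col-b⁻ Tb = cb
col-b⁻ Ts = co
col-b⁻ Td = cd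
col-b⁻ Tr = co

IsValidTiling : (L → Πc) → Set
IsValidTiling η =
  (∀ g h → g ≈ h → η g ≡ η h) ×
  (∀ g → col-a (η g) ≡ col-a⁻ (η (g · a))) ×
  (∀ g → col-b (η g) ≡ col-b⁻ (η (g · b)))

CombFormulas : (L → Πc) → Set
CombFormulas η =
  (∀ (n : ℤ) → η (a ^ n) ≡ TA) ×
  (∀ (n : ℤ) (m : ℕ) → 1 ≤ m → η ((a ^ n) · (b ^ (+ m))) ≡ Tb) ×
  (∀ (n : ℤ) (m : ℕ) → 1 ≤ m → η ((a ^ n) · (b ^ (- (+ m)))) ≡ Td) ×
  (∀ (n : ℤ) (m k : ℕ) → 1 ≤ k → k < m →
      η (((a ^ n) · (b ^ (+ m))) · (a ^ (- (+ k)))) ≡ Ts) ×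
  (∀ (n : ℤ) (m k : ℕ) → 1 ≤ k → 1 ≤ m →
      η (((a ^ n) · (b ^ (- (+ m)))) · (a ^ (- (+ k)))) ≡ Tr) ×
  (∀ (n : ℤ) (m k : ℕ) → 1 ≤ k → 1 ≤ m →
      η (((a ^ n) · (b ^ (+ m))) · (a ^ (+ k))) ≡ Tt)

InZ : L → Set
InZ g = ∃[ n ] ∃[ m ] ∃[ k ] (g ≈ (((a ^ n) · (b ^ m)) · (a ^ k)))

{-# OPTIONS --safe #-}
-- In a valid tiling with T_A at 1, the side colours force the tiles: colour a spreads T_A
-- along ⟨a⟩, colours b and d give T_b on a^n b^m and T_d on a^n b^-m, and colours t and r
-- then spread T_t and T_r along the arms. An s-coloured side also fits T_d, but a T_d on the
-- left arm of a^n b^m would spread r up to a^n b^m a^-m = a^(n+m) b^-m, which is a T_d.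
-- Conversely the comb tiling only looks at whether the lit lamps are none, one run of
-- consecutive lamps (the elements of Z), or have a gap, and at the position relative to the
-- run. a-edges keep the lamps, so they only need the tiles along a row to match; a b-edge
-- toggles one lamp, and the colours are matched case by case on where that lamp sits.
module Submission where

open import Defs
open import Data.Bool using (Bool; true; false; _xor_; if_then_else_)
open import Data.Bool.Properties using (xor-assoc; xor-comm; xor-identityʳ; xor-same; T-≡)
open import Data.Integer using (ℤ; +_; -[1+_]; +[1+_]; _+_; _-_; -_; ∣_∣)
import Data.Integer as ℤ
import Data.Integer.Properties as ℤ
open import Data.Integer.Tactic.RingSolver using (solve-∀)
open import Data.Nat using (ℕ; zero; suc; _<ᵇ_; _≤_; _<_; s≤s)
import Data.Nat as ℕ
import Data.Nat.Properties as ℕ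
open import Data.List using (List; []; _∷_; _++_; map)
open import Data.Nat.ListAction using (sum)
open import Data.Product using (Σ; _×_; _,_; proj₁; proj₂; ∃-syntax)
open import Data.Sum using (_⊎_; inj₁; inj₂; [_,_]′)
open import Data.Empty using (⊥; ⊥-elim)
open import Function.Base using (id; _∘_)
open import Function.Bundles using (mk⇔; Equivalence)
open import Relation.Nullary using (¬_; does; yes; no)
open import Relation.Nullary.Decidable using (dec-true; dec-false; does-⇔)
open import Relation.Binary.PropositionalEquality

-- Lamp configurations

infix 4 _==_
_==_ : ℤ → ℤ → Bool
x == y = does (x ℤ.≟ y)

==-refl : ∀ x → (x == x) ≡ true
==-refl x = dec-true (x ℤ.≟ x) refl

==-≢ : ∀ {x y} → x ≢ y → (x == y) ≡ false
==-≢ {x} {y} = dec-false (x ℤ.≟ y)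

+-cancelʳ : ∀ z {x y} → x + z ≡ y + z → x ≡ y
+-cancelʳ z {x} {y} eq = begin
  x           ≡⟨ sym (undo x z) ⟩
  x + z - z   ≡⟨ cong (_- z) eq ⟩
  y + z - z   ≡⟨ undo y z ⟩
  y           ∎
  where
  open ≡-Reasoning
  undo : ∀ w z → w + z - z ≡ w
  undo = solve-∀

==-+ʳ : ∀ z x y → (x + z == y + z) ≡ (x == y)
==-+ʳ z x y = does-⇔ (mk⇔ (+-cancelʳ z) (cong (_+ z))) (x + z ℤ.≟ y + z) (x ℤ.≟ y)

==-sub : ∀ n x y → (n + x == y) ≡ (x == y - n)
==-sub n x y = trans (sym (==-+ʳ (- n) (n + x) y)) (cong (_== y - n) (cancel n x))
  where
  cancel : ∀ n x → n + x - n ≡ x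
  cancel = solve-∀

toggle : (ℤ → Bool) → ℤ → ℤ → Bool
toggle h p i = h i xor (p == i)

toggle-involutive : ∀ h p → toggle (toggle h p) p ≗ h
toggle-involutive h p i = begin
  (h i xor (p == i)) xor (p == i)  ≡⟨ xor-assoc (h i) _ _ ⟩
  h i xor ((p == i) xor (p == i))  ≡⟨ cong (h i xor_) (xor-same (p == i)) ⟩
  h i xor false                    ≡⟨ xor-identityʳ (h i) ⟩
  h i                              ∎
  where open ≡-Reasoning

lamp-++ : ∀ c d i → lamp (c ++ d) i ≡ lamp c i xor lamp d i
lamp-++ []      d i = refl
lamp-++ (j ∷ c) d i = trans (cong ((j == i) xor_) (lamp-++ c d i)) (sym (xor-assoc (j == i) _ _))

lamp-shift : ∀ x d i → lamp (map (λ j → x + j) d) i ≡ lamp d (i - x)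
lamp-shift x []      i = refl
lamp-shift x (j ∷ d) i = cong₂ _xor_ (==-sub x j i) (lamp-shift x d i)

range : ℕ → ℤ → Bool
range n (+ k)    = k <ᵇ n
range n -[1+ _ ] = false

range-suc : ∀ n o → range (suc n) o ≡ (+ n == o) xor range n o
range-suc n (+ k)    = <ᵇ-suc n k
  where
  <ᵇ-suc : ∀ n k → (k <ᵇ suc n) ≡ (n ℕ.≡ᵇ k) xor (k <ᵇ n)
  <ᵇ-suc zero    zero    = refl
  <ᵇ-suc zero    (suc k) = refl
  <ᵇ-suc (suc n) zero    = refl
  <ᵇ-suc (suc n) (suc k) = <ᵇ-suc n k
range-suc n -[1+ k ] = refl

range-<⇒true : ∀ {n k} → k < n → range n (+ k) ≡ true
range-<⇒true k<n = Equivalence.to T-≡ (ℕ.<⇒<ᵇ k<n)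

range-true⇒< : ∀ {n k} → range n (+ k) ≡ true → k < n
range-true⇒< {n} {k} lit = ℕ.<ᵇ⇒< k n (Equivalence.from T-≡ lit)

range-≥⇒false : ∀ {n k} → n ≤ k → range n (+ k) ≡ false
range-≥⇒false {n} {k} n≤k with k <ᵇ n in lit
... | false = refl
... | true  = ⊥-elim (ℕ.<⇒≱ (range-true⇒< {n} {k} lit) n≤k)

range-nonneg : ∀ {n o} → range n o ≡ true → + 0 ℤ.≤ o
range-nonneg {o = + k} _ = ℤ.+≤+ ℕ.z≤n

range-convex : ∀ {n} q i j → range n q ≡ true → range n (q + + (i ℕ.+ j)) ≡ true → range n (q + + i) ≡ true
range-convex {n} (+ u) i j _ far =
  range-<⇒true {n} (ℕ.≤-<-trans (ℕ.+-monoʳ-≤ u (ℕ.m≤m+n i j)) (range-true⇒< {n} far))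

interval : ℤ → ℕ → ℤ → Bool
interval l n i = range n (i - l)

interval-offset : ∀ l m o → interval l m (l + o) ≡ range m o
interval-offset l m o = cong (range m) (cancel l o)
  where
  cancel : ∀ l o → l + o - l ≡ o
  cancel = solve-∀

interval-start : ∀ l n → interval l (suc n) l ≡ true
interval-start l n = cong (range (suc n)) (ℤ.+-inverseʳ l)

interval-convex : ∀ {l n} x i j → interval l n x ≡ true → interval l n (x + + (i ℕ.+ j)) ≡ true
                → interval l n (x + + i) ≡ true
interval-convex {l} {n} x i j near far =
  trans (cong (range n) (swap x (+ i) l))
        (range-convex (x - l) i j near (trans (cong (range n) (sym (swap x (+ (i ℕ.+ j)) l))) far))
  where
  swap : ∀ x i l → x + i - l ≡ x - l + i
  swap = solve-∀

-- Positions and lamps of elements of L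

lamps : L → ℤ → Bool
lamps g = lamp (cfg g)

lamps-· : ∀ g h i → lamps (g · h) i ≡ lamps g i xor lamps h (i - pos g)
lamps-· g h i = trans (lamp-++ (cfg g) _ i) (cong (lamps g i xor_) (lamp-shift (pos g) (cfg h) i))

lamps-·b : ∀ g → lamps (g · b) ≗ toggle (lamps g) (pos g)
lamps-·b g i = trans (lamps-· g b i) (cong (lamps g i xor_) (begin
  (+ 0 == i - pos g) xor false  ≡⟨ xor-identityʳ _ ⟩
  (+ 0 == i - pos g)            ≡⟨ cong (_== i - pos g) (sym (ℤ.+-inverseʳ (pos g))) ⟩
  (pos g - pos g == i - pos g)  ≡⟨ ==-+ʳ (- pos g) (pos g) i ⟩
  (pos g == i)                  ∎))
  where open ≡-Reasoning

pos-^ : ∀ {g} → pos g ≡ + 1 → ∀ z → pos (g ^ z) ≡ z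
pos-^ {g} p (+ n)    = up n
  where
  up : ∀ n → pos (npow g n) ≡ + n
  up zero    = refl
  up (suc n) = cong₂ _+_ p (up n)
pos-^ {g} p -[1+ n ] = down n
  where
  down : ∀ n → pos (npow (inv g) (suc n)) ≡ -[1+ n ]
  down zero    = trans (ℤ.+-identityʳ _) (cong -_ p)
  down (suc n) = cong₂ _+_ (cong -_ p) (down n)

pos-a^ : ∀ z → pos (a ^ z) ≡ z
pos-a^ = pos-^ refl

pos-b^ : ∀ z → pos (b ^ z) ≡ z
pos-b^ = pos-^ refl

npow-lampless : ∀ {g} → cfg g ≡ [] → ∀ n → cfg (npow g n) ≡ []
npow-lampless c zero    = refl
npow-lampless c (suc n) = cong₂ (λ u v → u ++ map _ v) c (npow-lampless c n)

cfg-a^ : ∀ z → cfg (a ^ z) ≡ []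
cfg-a^ (+ n)    = npow-lampless refl n
cfg-a^ -[1+ n ] = npow-lampless refl (suc n)

lamps-a^ : ∀ z i → lamps (a ^ z) i ≡ false
lamps-a^ z i = cong (λ c → lamp c i) (cfg-a^ z)

lamps-·a : ∀ g → lamps (g · a) ≗ lamps g
lamps-·a g i = trans (lamps-· g a i) (xor-identityʳ (lamps g i))

lamps-·a^ : ∀ g z → lamps (g · (a ^ z)) ≗ lamps g
lamps-·a^ g z i = begin
  lamps (g · (a ^ z)) i                    ≡⟨ lamps-· g (a ^ z) i ⟩
  lamps g i xor lamps (a ^ z) (i - pos g)  ≡⟨ cong (lamps g i xor_) (lamps-a^ z _) ⟩
  lamps g i xor false                      ≡⟨ xor-identityʳ _ ⟩
  lamps g i                                ∎
  where open ≡-Reasoning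

lamps-b^+ : ∀ m → lamps (b ^ (+ m)) ≗ range m
lamps-b^+ zero    (+ k)    = refl
lamps-b^+ zero    -[1+ k ] = refl
lamps-b^+ (suc m) i =
  trans (lamps-· b (b ^ (+ m)) i) (trans (cong (lamps b i xor_) (lamps-b^+ m (i - + 1))) (shifted i))
  where
  shifted : ∀ i → lamps b i xor range m (i - + 1) ≡ range (suc m) i
  shifted (+ zero)  = refl
  shifted +[1+ k ]  = refl
  shifted -[1+ k ]  = refl

lamps-npow-b⁻¹ : ∀ m i → lamps (npow (inv b) m) i ≡ range m (i + + m)
lamps-npow-b⁻¹ zero i with i + + 0
... | + k      = refl
... | -[1+ k ] = refl
lamps-npow-b⁻¹ (suc m) i = begin
  lamps (inv b · npow (inv b) m) i
    ≡⟨ lamps-· (inv b) (npow (inv b) m) i ⟩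
  ((-[1+ 0 ] == i) xor false) xor lamps (npow (inv b) m) (i + + 1)
    ≡⟨ cong₂ _xor_ (xor-identityʳ (-[1+ 0 ] == i)) (lamps-npow-b⁻¹ m (i + + 1)) ⟩
  (-[1+ 0 ] == i) xor range m (i + + 1 + + m)
    ≡⟨ cong₂ _xor_ (sym (==-+ʳ (+ suc m) -[1+ 0 ] i)) (cong (range m) (reassoc i (+ m))) ⟩
  (+ m == i + + suc m) xor range m (i + + suc m)
    ≡⟨ sym (range-suc m (i + + suc m)) ⟩
  range (suc m) (i + + suc m)
    ∎
  where
  open ≡-Reasoning
  reassoc : ∀ i m → i + + 1 + m ≡ i + (+ 1 + m)
  reassoc = solve-∀

lamps-a^· : ∀ n h i → lamps ((a ^ n) · h) i ≡ lamps h (i - n)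
lamps-a^· n h i = trans (lamps-· (a ^ n) h i) (cong₂ (λ u v → u xor lamps h (i - v)) (lamps-a^ n i) (pos-a^ n))

lamps-a^b^+ : ∀ n m → lamps ((a ^ n) · (b ^ (+ m))) ≗ interval n m
lamps-a^b^+ n m i = trans (lamps-a^· n (b ^ (+ m)) i) (lamps-b^+ m (i - n))

lamps-a^b^- : ∀ n m → lamps ((a ^ n) · (b ^ -[1+ m ])) ≗ interval (n - + suc m) (suc m)
lamps-a^b^- n m i =
  trans (lamps-a^· n (b ^ -[1+ m ]) i)
        (trans (lamps-npow-b⁻¹ (suc m) (i - n)) (cong (range (suc m)) (reassoc i n (+ suc m))))
  where
  reassoc : ∀ i n k → i - n + k ≡ i - (n - k)
  reassoc = solve-∀

pos-a^b^ : ∀ n z → pos ((a ^ n) · (b ^ z)) ≡ n + z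
pos-a^b^ n z = cong₂ _+_ (pos-a^ n) (pos-b^ z)

lamps-b^·b : ∀ z j → lamps (b ^ z) j xor (z == j) ≡ lamps (b ^ (z + + 1)) j
lamps-b^·b (+ m) j = begin
  lamps (b ^ (+ m)) j xor (+ m == j) ≡⟨ cong (_xor (+ m == j)) (lamps-b^+ m j) ⟩
  range m j xor (+ m == j)   ≡⟨ xor-comm (range m j) _ ⟩
  (+ m == j) xor range m j   ≡⟨ sym (range-suc m j) ⟩
  range (suc m) j            ≡⟨ cong (λ k → range k j) (ℕ.+-comm 1 m) ⟩
  range (m ℕ.+ 1) j          ≡⟨ sym (lamps-b^+ (m ℕ.+ 1) j) ⟩
  lamps (b ^ (+ m + + 1)) j  ∎
  where open ≡-Reasoning
lamps-b^·b -[1+ zero ] j = trans (cong (_xor (-[1+ 0 ] == j)) (lamps-npow-b⁻¹ 1 j)) (cancelled j)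
  where
  cancelled : ∀ j → range 1 (j + + 1) xor (-[1+ 0 ] == j) ≡ false
  cancelled (+ zero)          = refl
  cancelled +[1+ k ]          = refl
  cancelled -[1+ zero ]       = refl
  cancelled -[1+ suc k ]      = refl
lamps-b^·b -[1+ suc m ] j = begin
  lamps (b ^ -[1+ suc m ]) j xor (-[1+ suc m ] == j)
    ≡⟨ cong (_xor (-[1+ suc m ] == j)) (lamps-npow-b⁻¹ (suc (suc m)) j) ⟩
  range (suc (suc m)) (j + + suc (suc m)) xor (-[1+ suc m ] == j)
    ≡⟨ cong₂ _xor_ (cong (range (suc (suc m))) (shift j (+ suc m))) moved ⟩
  range (suc (suc m)) (+ 1 + o) xor (-[1+ 0 ] == o)
    ≡⟨ shrunk o ⟩
  range (suc m) o
    ≡⟨ sym (lamps-npow-b⁻¹ (suc m) j) ⟩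
  lamps (b ^ -[1+ m ]) j
    ∎
  where
  open ≡-Reasoning
  o = j + + suc m
  shift : ∀ j k → j + (+ 1 + k) ≡ + 1 + (j + k)
  shift = solve-∀
  cancel : ∀ k → - (+ 1 + k) + k ≡ - + 1
  cancel = solve-∀
  moved : (-[1+ suc m ] == j) ≡ (-[1+ 0 ] == o)
  moved = trans (sym (==-+ʳ (+ suc m) -[1+ suc m ] j)) (cong (_== o) (cancel (+ suc m)))
  shrunk : ∀ o → range (suc (suc m)) (+ 1 + o) xor (-[1+ 0 ] == o) ≡ range (suc m) o
  shrunk (+ k)            = xor-identityʳ _
  shrunk -[1+ zero ]      = refl
  shrunk -[1+ suc k ]     = refl

≈-sym : ∀ {g h} → g ≈ h → h ≈ g
≈-sym (p , l) = sym p , λ i → sym (l i)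

·a^-≈ : ∀ g z h → pos g + z ≡ pos h → lamps g ≗ lamps h → (g · (a ^ z)) ≈ h
·a^-≈ g z h p l = trans (cong (λ x → pos g + x) (pos-a^ z)) p , λ i → trans (lamps-·a^ g z i) (l i)

·a^·a-≈ : ∀ g z {w} → z + + 1 ≡ w → ((g · (a ^ z)) · a) ≈ (g · (a ^ w))
·a^·a-≈ g z {w} z+1≡w = position , λ i → begin
  lamps ((g · (a ^ z)) · a) i      ≡⟨ lamps-·a (g · (a ^ z)) i ⟩
  lamps (g · (a ^ z)) i            ≡⟨ lamps-·a^ g z i ⟩
  lamps g i                        ≡⟨ sym (lamps-·a^ g w i) ⟩
  lamps (g · (a ^ w)) i            ∎
  where
  open ≡-Reasoning
  position : pos g + pos (a ^ z) + + 1 ≡ pos g + pos (a ^ w)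
  position = begin
    pos g + pos (a ^ z) + + 1  ≡⟨ ℤ.+-assoc (pos g) _ _ ⟩
    pos g + (pos (a ^ z) + + 1)  ≡⟨ cong (λ x → pos g + (x + + 1)) (pos-a^ z) ⟩
    pos g + (z + + 1)            ≡⟨ cong (λ x → pos g + x) (trans z+1≡w (sym (pos-a^ w))) ⟩
    pos g + pos (a ^ w)          ∎

·a^0-≈ : ∀ g → (g · (a ^ (+ 0))) ≈ g
·a^0-≈ g = ·a^-≈ g (+ 0) g (ℤ.+-identityʳ (pos g)) (λ _ → refl)

a^b^·b-≈ : ∀ n z {w} → z + + 1 ≡ w → (((a ^ n) · (b ^ z)) · b) ≈ ((a ^ n) · (b ^ w))
a^b^·b-≈ n z {w} z+1≡w = position , λ i → begin
  lamps (((a ^ n) · (b ^ z)) · b) i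
      ≡⟨ lamps-·b ((a ^ n) · (b ^ z)) i ⟩
  toggle (lamps ((a ^ n) · (b ^ z))) (pos ((a ^ n) · (b ^ z))) i
      ≡⟨ cong₂ _xor_ (lamps-a^· n (b ^ z) i) (trans (cong (_== i) (pos-a^b^ n z)) (==-sub n z i)) ⟩
  lamps (b ^ z) (i - n) xor (z == i - n)
      ≡⟨ lamps-b^·b z (i - n) ⟩
  lamps (b ^ (z + + 1)) (i - n)
      ≡⟨ cong (λ u → lamps (b ^ u) (i - n)) z+1≡w ⟩
  lamps (b ^ w) (i - n)
      ≡⟨ sym (lamps-a^· n (b ^ w) i) ⟩
  lamps ((a ^ n) · (b ^ w)) i
      ∎
  where
  open ≡-Reasoning
  position : pos ((a ^ n) · (b ^ z)) + + 1 ≡ pos ((a ^ n) · (b ^ w))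
  position = begin
    pos ((a ^ n) · (b ^ z)) + + 1  ≡⟨ cong (_+ + 1) (pos-a^b^ n z) ⟩
    n + z + + 1                    ≡⟨ ℤ.+-assoc n z (+ 1) ⟩
    n + (z + + 1)                  ≡⟨ cong (λ x → n + x) z+1≡w ⟩
    n + w                          ≡⟨ sym (pos-a^b^ n w) ⟩
    pos ((a ^ n) · (b ^ w))        ∎

a^b^0-≈ : ∀ n → ((a ^ n) · (b ^ (+ 0))) ≈ (a ^ n)
a^b^0-≈ n = trans (pos-a^b^ n (+ 0)) (trans (ℤ.+-identityʳ n) (sym (pos-a^ n)))
          , λ i → trans (lamps-a^· n (b ^ (+ 0)) i) (sym (lamps-a^ n i))

-- Valid tilings with T_A at the identity

col-a⁻≡ca⇒TA : ∀ X → col-a⁻ X ≡ ca → X ≡ TA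
col-a⁻≡ca⇒TA TA _ = refl
col-a⁻≡ca⇒TA Tt ()
col-a⁻≡ca⇒TA Tb ()
col-a⁻≡ca⇒TA Ts ()
col-a⁻≡ca⇒TA Td ()
col-a⁻≡ca⇒TA Tr ()

col-a≡ca⇒TA : ∀ X → col-a X ≡ ca → X ≡ TA
col-a≡ca⇒TA TA _ = refl
col-a≡ca⇒TA Tt ()
col-a≡ca⇒TA Tb ()
col-a≡ca⇒TA Ts ()
col-a≡ca⇒TA Td ()
col-a≡ca⇒TA Tr ()

col-a⁻≡ct⇒Tt : ∀ X → col-a⁻ X ≡ ct → X ≡ Tt
col-a⁻≡ct⇒Tt TA ()
col-a⁻≡ct⇒Tt Tt _ = refl
col-a⁻≡ct⇒Tt Tb ()
col-a⁻≡ct⇒Tt Ts ()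
col-a⁻≡ct⇒Tt Td ()
col-a⁻≡ct⇒Tt Tr ()

col-a≡cr⇒Tr : ∀ X → col-a X ≡ cr → X ≡ Tr
col-a≡cr⇒Tr TA ()
col-a≡cr⇒Tr Tt ()
col-a≡cr⇒Tr Tb ()
col-a≡cr⇒Tr Ts ()
col-a≡cr⇒Tr Td ()
col-a≡cr⇒Tr Tr _ = refl

col-a≡cs⇒Ts⊎Td : ∀ X → col-a X ≡ cs → X ≡ Ts ⊎ X ≡ Td
col-a≡cs⇒Ts⊎Td TA ()
col-a≡cs⇒Ts⊎Td Tt ()
col-a≡cs⇒Ts⊎Td Tb ()
col-a≡cs⇒Ts⊎Td Ts _ = inj₁ refl
col-a≡cs⇒Ts⊎Td Td _ = inj₂ refl
col-a≡cs⇒Ts⊎Td Tr ()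

col-b⁻≡cb⇒Tb : ∀ X → col-b⁻ X ≡ cb → X ≡ Tb
col-b⁻≡cb⇒Tb TA ()
col-b⁻≡cb⇒Tb Tt ()
col-b⁻≡cb⇒Tb Tb _ = refl
col-b⁻≡cb⇒Tb Ts ()
col-b⁻≡cb⇒Tb Td ()
col-b⁻≡cb⇒Tb Tr ()

col-b≡cd⇒Td : ∀ X → col-b X ≡ cd → X ≡ Td
col-b≡cd⇒Td TA ()
col-b≡cd⇒Td Tt ()
col-b≡cd⇒Td Tb ()
col-b≡cd⇒Td Ts ()
col-b≡cd⇒Td Td _ = refl
col-b≡cd⇒Td Tr ()

module Forced (η : L → Πc) (valid : IsValidTiling η) where

  η-resp : ∀ {g h} → g ≈ h → η g ≡ η h
  η-resp = proj₁ valid _ _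

  a-edge : ∀ g z {w} → z + + 1 ≡ w → col-a (η (g · (a ^ z))) ≡ col-a⁻ (η (g · (a ^ w)))
  a-edge g z z+1≡w = trans (proj₁ (proj₂ valid) _) (cong col-a⁻ (η-resp (·a^·a-≈ g z z+1≡w)))

  b-edge : ∀ n z {w} → z + + 1 ≡ w → col-b (η ((a ^ n) · (b ^ z))) ≡ col-b⁻ (η ((a ^ n) · (b ^ w)))
  b-edge n z z+1≡w = trans (proj₂ (proj₂ valid) _) (cong col-b⁻ (η-resp (a^b^·b-≈ n z z+1≡w)))

  spread-right : ∀ g {T} → (∀ X → col-a⁻ X ≡ col-a T → X ≡ T) → col-a (η g) ≡ col-a T
               → ∀ k → η (g · (a ^ (+ suc k))) ≡ T
  spread-right g {T} forced start k = forced _ (trans (sym (a-edge g (+ k) (cong +_ (ℕ.+-comm k 1)))) (previous k))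
    where
    previous : ∀ k → col-a (η (g · (a ^ (+ k)))) ≡ col-a T
    previous zero    = trans (cong col-a (η-resp (·a^0-≈ g))) start
    previous (suc k) = cong col-a (spread-right g forced start k)

  spread-left : ∀ g {T} → (∀ X → col-a X ≡ col-a⁻ T → X ≡ T) → col-a⁻ (η g) ≡ col-a⁻ T
              → ∀ k → η (g · (a ^ -[1+ k ])) ≡ T
  spread-left g {T} forced start k = forced _ (trans (a-edge g -[1+ k ] refl) (next k))
    where
    next : ∀ k → col-a⁻ (η (g · (a ^ (-[1+ k ] + + 1)))) ≡ col-a⁻ T
    next zero    = trans (cong col-a⁻ (η-resp (·a^0-≈ g))) start
    next (suc k) = cong col-a⁻ (spread-left g forced start k)

module Forward (η : L → Πc) (valid : IsValidTiling η) (η-e : η e ≡ TA) where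
  open Forced η valid

  η-a^ : ∀ z → η (a ^ z) ≡ TA
  η-a^ z = trans (sym (η-resp e·a^z≈a^z)) (along z)
    where
    e·a^z≈a^z : (e · (a ^ z)) ≈ (a ^ z)
    e·a^z≈a^z = ·a^-≈ e z (a ^ z) (trans (ℤ.+-identityˡ z) (sym (pos-a^ z))) (λ i → sym (lamps-a^ z i))
    along : ∀ z → η (e · (a ^ z)) ≡ TA
    along (+ zero) = trans (η-resp (·a^0-≈ e)) η-e
    along +[1+ k ] = spread-right e col-a⁻≡ca⇒TA (cong col-a η-e) k
    along -[1+ k ] = spread-left e col-a≡ca⇒TA (cong col-a⁻ η-e) k

  η-a^b^+ : ∀ n m → η ((a ^ n) · (b ^ +[1+ m ])) ≡ Tb
  η-a^b^+ n m = col-b⁻≡cb⇒Tb _ (trans (sym (b-edge n (+ m) (cong +_ (ℕ.+-comm m 1)))) (below m))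
    where
    below : ∀ m → col-b (η ((a ^ n) · (b ^ (+ m)))) ≡ cb
    below zero    = cong col-b (trans (η-resp (a^b^0-≈ n)) (η-a^ n))
    below (suc m) = cong col-b (η-a^b^+ n m)

  η-a^b^- : ∀ n m → η ((a ^ n) · (b ^ -[1+ m ])) ≡ Td
  η-a^b^- n m = col-b≡cd⇒Td _ (trans (b-edge n -[1+ m ] refl) (above m))
    where
    above : ∀ m → col-b⁻ (η ((a ^ n) · (b ^ (-[1+ m ] + + 1)))) ≡ cd
    above zero    = cong col-b⁻ (trans (η-resp (a^b^0-≈ n)) (η-a^ n))
    above (suc m) = cong col-b⁻ (η-a^b^- n m)

  η-a^b^+a^+ : ∀ n m k → η (((a ^ n) · (b ^ +[1+ m ])) · (a ^ +[1+ k ])) ≡ Tt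
  η-a^b^+a^+ n m = spread-right ((a ^ n) · (b ^ +[1+ m ])) col-a⁻≡ct⇒Tt (cong col-a (η-a^b^+ n m))

  η-a^b^-a^- : ∀ n m k → η (((a ^ n) · (b ^ -[1+ m ])) · (a ^ -[1+ k ])) ≡ Tr
  η-a^b^-a^- n m = spread-left ((a ^ n) · (b ^ -[1+ m ])) col-a≡cr⇒Tr (cong col-a⁻ (η-a^b^- n m))

  η-a^b^+a^-≢Td : ∀ n m k → suc k < m → η (((a ^ n) · (b ^ (+ m))) · (a ^ -[1+ k ])) ≢ Td
  η-a^b^+a^-≢Td n m k k+1<m isTd with ℕ.m≤n⇒∃[o]m+o≡n k+1<m
  ... | j , refl = Tr≢Td (begin
    Tr                                                                 ≡⟨ sym (spread-left left-arm col-a≡cr⇒Tr (cong col-a⁻ isTd) j) ⟩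
    η (left-arm · (a ^ -[1+ j ]))                                       ≡⟨ η-resp meets ⟩
    η ((a ^ (n + + M)) · (b ^ -[1+ suc (k ℕ.+ j) ]))                    ≡⟨ η-a^b^- (n + + M) (suc (k ℕ.+ j)) ⟩
    Td                                                                 ∎)
    where
    open ≡-Reasoning
    M = suc (suc (k ℕ.+ j))
    left-arm = ((a ^ n) · (b ^ (+ M))) · (a ^ -[1+ k ])
    Tr≢Td : Tr ≢ Td
    Tr≢Td ()
    cancel : ∀ n M → n + M - M ≡ n
    cancel = solve-∀
    meets : (left-arm · (a ^ -[1+ j ])) ≈ ((a ^ (n + + M)) · (b ^ -[1+ suc (k ℕ.+ j) ]))
    meets = ·a^-≈ left-arm -[1+ j ] ((a ^ (n + + M)) · (b ^ -[1+ suc (k ℕ.+ j) ]))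
      (begin
        pos ((a ^ n) · (b ^ (+ M))) + pos (a ^ -[1+ k ]) + -[1+ j ]
          ≡⟨ cong₂ (λ x y → x + y + -[1+ j ]) (pos-a^b^ n (+ M)) (pos-a^ -[1+ k ]) ⟩
        n + + M + -[1+ k ] + -[1+ j ]                              ≡⟨ ℤ.+-assoc (n + + M) -[1+ k ] -[1+ j ] ⟩
        n + + M + -[1+ suc (k ℕ.+ j) ]                              ≡⟨ sym (pos-a^b^ (n + + M) _) ⟩
        pos ((a ^ (n + + M)) · (b ^ -[1+ suc (k ℕ.+ j) ]))           ∎)
      (λ i → begin
        lamps (((a ^ n) · (b ^ (+ M))) · (a ^ -[1+ k ])) i  ≡⟨ lamps-·a^ ((a ^ n) · (b ^ (+ M))) -[1+ k ] i ⟩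
        lamps ((a ^ n) · (b ^ (+ M))) i                     ≡⟨ lamps-a^b^+ n M i ⟩
        interval n M i                                      ≡⟨ cong (λ l → interval l M i) (sym (cancel n (+ M))) ⟩
        interval (n + + M - + M) M i                        ≡⟨ sym (lamps-a^b^- (n + + M) (suc (k ℕ.+ j)) i) ⟩
        lamps ((a ^ (n + + M)) · (b ^ -[1+ suc (k ℕ.+ j) ])) i ∎)

  η-a^b^+a^- : ∀ n m k → suc k < m → η (((a ^ n) · (b ^ (+ m))) · (a ^ -[1+ k ])) ≡ Ts
  η-a^b^+a^- n (suc m) k k+1<m =
    [ id , (λ isTd → ⊥-elim (η-a^b^+a^-≢Td n (suc m) k k+1<m isTd)) ]′
      (col-a≡cs⇒Ts⊎Td _ (trans (a-edge ((a ^ n) · (b ^ (+ suc m))) -[1+ k ] refl) (right-neighbour k k+1<m)))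
    where
    right-neighbour : ∀ k → suc k < suc m → col-a⁻ (η (((a ^ n) · (b ^ (+ suc m))) · (a ^ (-[1+ k ] + + 1)))) ≡ cs
    right-neighbour zero    _     = cong col-a⁻ (trans (η-resp (·a^0-≈ ((a ^ n) · (b ^ (+ suc m))))) (η-a^b^+ n m))
    right-neighbour (suc k) k+1<m = cong col-a⁻ (η-a^b^+a^- n (suc m) k (ℕ.<-trans (ℕ.n<1+n (suc k)) k+1<m))

forward : (η : L → Πc) → IsValidTiling η → η e ≡ TA → CombFormulas η
forward η valid η-e =
    η-a^
  , (λ { n (suc m) _ → η-a^b^+ n m })
  , (λ { n (suc m) _ → η-a^b^- n m })
  , (λ { n m (suc k) _ k<m → η-a^b^+a^- n m k k<m })
  , (λ { n (suc m) (suc k) _ _ → η-a^b^-a^- n m k })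
  , (λ { n (suc m) (suc k) _ _ → η-a^b^+a^+ n m k })
  where open Forward η valid η-e

-- Shapes of lamp configurations

data Shape (h : ℤ → Bool) : Set where
  unlit : (∀ i → h i ≡ false) → Shape h
  run   : (l : ℤ) (n : ℕ) → h ≗ interval l (suc n) → Shape h
  gap   : (x : ℤ) (i j : ℕ) → h x ≡ true → h (x + +[1+ i ]) ≡ false
        → h (x + + (suc i ℕ.+ suc j)) ≡ true → Shape h

shape-cast : ∀ {h h'} → h ≗ h' → Shape h → Shape h'
shape-cast h≗h' (unlit dark)        = unlit λ i → trans (sym (h≗h' i)) (dark i)
shape-cast h≗h' (run l n h≗run)     = run l n λ i → trans (sym (h≗h' i)) (h≗run i)
shape-cast h≗h' (gap x i j on off on′) =
  gap x i j (trans (sym (h≗h' _)) on) (trans (sym (h≗h' _)) off) (trans (sym (h≗h' _)) on′)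

tileAfter : ℕ → ℕ → Πc
tileAfter zero    zero    = Tb
tileAfter zero    (suc n) = Ts
tileAfter (suc k) zero    = Tt
tileAfter (suc k) (suc n) = tileAfter k n

-- The tile at offset d from the start of a run of n + 1 lamps: in a^l b^(n+1) a^k the
-- lamplighter stands at offset n + 1 + k.
runTile : ℕ → ℤ → Πc
runTile n -[1+ _ ] = Tr
runTile n (+ zero) = Td
runTile n +[1+ k ] = tileAfter k n

tile : ∀ {h} → Shape h → ℤ → Πc
tile (unlit _)           p = TA
tile (run l n _)         p = runTile n (p - l)
tile (gap _ _ _ _ _ _)   p = Tt

tileAfter-≡ : ∀ k → tileAfter k k ≡ Tb
tileAfter-≡ zero    = refl
tileAfter-≡ (suc k) = tileAfter-≡ k

tileAfter-< : ∀ {k n} → k < n → tileAfter k n ≡ Ts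
tileAfter-< {zero}  {suc n} _         = refl
tileAfter-< {suc k} {suc n} (s≤s k<n) = tileAfter-< k<n

tileAfter-> : ∀ {k n} → n < k → tileAfter k n ≡ Tt
tileAfter-> {suc k} {zero}  _         = refl
tileAfter-> {suc k} {suc n} (s≤s n<k) = tileAfter-> n<k

false≢true : false ≢ true
false≢true ()

run-no-gap : ∀ {h l n} x i j → h ≗ interval l (suc n) → h x ≡ true → h (x + +[1+ i ]) ≡ false
           → h (x + + (suc i ℕ.+ suc j)) ≡ true → ⊥
run-no-gap x i j h≗run on off on′ = false≢true (trans (sym off) (trans (h≗run _)
  (interval-convex x (suc i) (suc j) (trans (sym (h≗run x)) on) (trans (sym (h≗run _)) on′))))

run-unique : ∀ {l n l' n'} → interval l (suc n) ≗ interval l' (suc n') → l ≡ l' × n ≡ n'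
run-unique {l} {n} {l'} {n'} same = l≡l' , ℕ.≤-antisym (length≤ same′) (length≤ (λ i → sym (same′ i)))
  where
  start≤ : ∀ {l n l' n'} → interval l (suc n) ≗ interval l' (suc n') → l' ℤ.≤ l
  start≤ {l} {n} same = ℤ.0≤i-j⇒j≤i (range-nonneg (trans (sym (same l)) (interval-start l n)))
  l≡l' : l ≡ l'
  l≡l' = ℤ.≤-antisym (start≤ (λ i → sym (same i))) (start≤ same)
  same′ : interval l (suc n) ≗ interval l (suc n')
  same′ i = trans (same i) (cong (λ x → interval x (suc n') i) (sym l≡l'))
  length≤ : ∀ {n n'} → interval l (suc n) ≗ interval l (suc n') → n ≤ n'
  length≤ {n} {n'} same = ℕ.≤-pred (range-true⇒< {suc n'} (begin
    range (suc n') (+ n)           ≡⟨ sym (interval-offset l (suc n') (+ n)) ⟩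
    interval l (suc n') (l + + n)  ≡⟨ sym (same (l + + n)) ⟩
    interval l (suc n) (l + + n)   ≡⟨ interval-offset l (suc n) (+ n) ⟩
    range (suc n) (+ n)            ≡⟨ range-<⇒true {suc n} (ℕ.n<1+n n) ⟩
    true                           ∎))
    where open ≡-Reasoning

lit-not-unlit : ∀ {h : ℤ → Bool} x → (∀ i → h i ≡ false) → h x ≡ true → ⊥
lit-not-unlit x dark lit = false≢true (trans (sym (dark x)) lit)

run-lit : ∀ {h l n} → h ≗ interval l (suc n) → h l ≡ true
run-lit {l = l} {n} h≗run = trans (h≗run l) (interval-start l n)

tile-unique : ∀ {h h'} (C : Shape h) (D : Shape h') → h ≗ h' → ∀ p → tile C p ≡ tile D p
tile-unique (unlit _)              (unlit _)              _    p = refl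
tile-unique (unlit dark)           (run l _ h'≗run)       h≗h' p =
  ⊥-elim (lit-not-unlit l dark (trans (h≗h' l) (run-lit h'≗run)))
tile-unique (unlit dark)           (gap x _ _ on _ _)     h≗h' p =
  ⊥-elim (lit-not-unlit x dark (trans (h≗h' x) on))
tile-unique (run l _ h≗run)        (unlit dark)           h≗h' p =
  ⊥-elim (lit-not-unlit l dark (trans (sym (h≗h' l)) (run-lit h≗run)))
tile-unique (run l n h≗run)        (run l' n' h'≗run)     h≗h' p
  with run-unique {l} {n} {l'} {n'} (λ i → trans (sym (h≗run i)) (trans (h≗h' i) (h'≗run i)))
... | refl , refl = refl
tile-unique (run _ _ h≗run)        (gap x i j on off on′) h≗h' p =
  ⊥-elim (run-no-gap x i j (λ y → trans (sym (h≗h' y)) (h≗run y)) on off on′)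
tile-unique (gap x _ _ on _ _)     (unlit dark)           h≗h' p =
  ⊥-elim (lit-not-unlit x dark (trans (sym (h≗h' x)) on))
tile-unique (gap x i j on off on′) (run _ _ h'≗run)       h≗h' p =
  ⊥-elim (run-no-gap x i j (λ y → trans (h≗h' y) (h'≗run y)) on off on′)
tile-unique (gap _ _ _ _ _ _)      (gap _ _ _ _ _ _)      _    p = refl

tileAfter-a-edge : ∀ k n → col-a (tileAfter k n) ≡ col-a⁻ (tileAfter (suc k) n)
tileAfter-a-edge zero    zero          = refl
tileAfter-a-edge zero    (suc zero)    = refl
tileAfter-a-edge zero    (suc (suc n)) = refl
tileAfter-a-edge (suc k) zero          = refl
tileAfter-a-edge (suc k) (suc n)       = tileAfter-a-edge k n

runTile-a-edge : ∀ n d → col-a (runTile n d) ≡ col-a⁻ (runTile n (+ 1 + d))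
runTile-a-edge n       -[1+ zero ]  = refl
runTile-a-edge n       -[1+ suc k ] = refl
runTile-a-edge zero    (+ zero)     = refl
runTile-a-edge (suc n) (+ zero)     = refl
runTile-a-edge n       +[1+ k ]     = tileAfter-a-edge k n

tile-a-edge : ∀ {h} (C : Shape h) p → col-a (tile C p) ≡ col-a⁻ (tile C (p + + 1))
tile-a-edge (unlit _)         p = refl
tile-a-edge (run l n _)       p = trans (runTile-a-edge n (p - l)) (cong (col-a⁻ ∘ runTile n) (sym (step p l)))
  where
  step : ∀ p l → p + + 1 - l ≡ + 1 + (p - l)
  step = solve-∀
tile-a-edge (gap _ _ _ _ _ _) p = refl

-- A b-edge joins lamplighter position p to p + 1 and toggles the lamp at p.
record Toggled {h} (C : Shape h) (p : ℤ) : Set where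
  field
    shape : Shape (toggle h p)
    forth : col-b (tile C p) ≡ col-b⁻ (tile shape (p + + 1))
    back  : col-b (tile shape p) ≡ col-b⁻ (tile C (p + + 1))

toggle-unlit : ∀ {h} (dark : ∀ i → h i ≡ false) p → Toggled (unlit dark) p
toggle-unlit {h} dark p = record
  { shape = run p 0 single
  ; forth = cong (col-b⁻ ∘ runTile 0) (sym (step p))
  ; back  = cong (col-b ∘ runTile 0) (ℤ.+-inverseʳ p)
  }
  where
  step : ∀ p → p + + 1 - p ≡ + 1
  step = solve-∀
  at-origin : ∀ o → (+ 0 == o) ≡ range 1 o
  at-origin (+ zero) = refl
  at-origin +[1+ k ] = refl
  at-origin -[1+ k ] = refl
  single : toggle h p ≗ interval p 1
  single x = begin
    h x xor (p == x)       ≡⟨ cong (_xor (p == x)) (dark x) ⟩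
    (p == x)               ≡⟨ sym (==-+ʳ (- p) p x) ⟩
    (p - p == x - p)       ≡⟨ cong (_== x - p) (ℤ.+-inverseʳ p) ⟩
    (+ 0 == x - p)         ≡⟨ at-origin (x - p) ⟩
    range 1 (x - p)        ∎
    where open ≡-Reasoning

-- Offsets are measured from the start l of the run and the toggled lamp sits at offset d; a
-- resulting run of n' + 1 lamps starting at l - δ is lit at offset o iff 0 ≤ δ + o ≤ n'.
module ToggleRun {h : ℤ → Bool} {l : ℤ} {n : ℕ} (h≗run : h ≗ interval l (suc n))
                 (p d : ℤ) (p-l≡d : p - l ≡ d) where

  toggled : ℤ → Bool
  toggled = toggle (range (suc n)) d

  toggled-at : ∀ x → toggle h p x ≡ toggled (x - l)
  toggled-at x = cong₂ _xor_ (h≗run x) (trans (sym (==-+ʳ (- l) p x)) (cong (_== x - l) p-l≡d))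

  toggled-at-offset : ∀ o → toggle h p (l + o) ≡ toggled o
  toggled-at-offset o = trans (toggled-at (l + o)) (cong toggled (cancel l o))
    where
    cancel : ∀ l o → l + o - l ≡ o
    cancel = solve-∀

  next-offset : p + + 1 - l ≡ + 1 + d
  next-offset = trans (step p l) (cong (λ x → + 1 + x) p-l≡d)
    where
    step : ∀ p l → p + + 1 - l ≡ + 1 + (p - l)
    step = solve-∀

  moved-start : ∀ x δ → x - (l - δ) ≡ δ + (x - l)
  moved-start x δ = reassoc x l δ
    where
    reassoc : ∀ x l δ → x - (l - δ) ≡ δ + (x - l)
    reassoc = solve-∀

  as-run : (δ : ℤ) (n' : ℕ) → (∀ o → toggled o ≡ range (suc n') (δ + o))
         → col-b (runTile n d) ≡ col-b⁻ (runTile n' (δ + (+ 1 + d)))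
         → col-b (runTile n' (δ + d)) ≡ col-b⁻ (runTile n (+ 1 + d))
         → Toggled (run l n h≗run) p
  as-run δ n' shifted forth back = record
    { shape = run (l - δ) n' λ x →
        trans (toggled-at x) (trans (shifted (x - l)) (cong (range (suc n')) (sym (moved-start x δ))))
    ; forth = trans (cong (col-b ∘ runTile n) p-l≡d)
                (trans forth (cong (col-b⁻ ∘ runTile n')
                  (sym (trans (moved-start (p + + 1) δ) (cong (λ x → δ + x) next-offset)))))
    ; back  = trans (cong (col-b ∘ runTile n') (trans (moved-start p δ) (cong (λ x → δ + x) p-l≡d)))
                (trans back (cong (col-b⁻ ∘ runTile n) (sym next-offset)))
    }

  as-gap : ∀ o i j → toggled o ≡ true → toggled (o + +[1+ i ]) ≡ false
         → toggled (o + + (suc i ℕ.+ suc j)) ≡ true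
         → col-b (runTile n d) ≡ co → co ≡ col-b⁻ (runTile n (+ 1 + d))
         → Toggled (run l n h≗run) p
  as-gap o i j on off on′ forth back = record
    { shape = gap (l + o) i j (trans (toggled-at-offset o) on) (beside (+[1+ i ]) off) (beside _ on′)
    ; forth = trans (cong (col-b ∘ runTile n) p-l≡d) forth
    ; back  = trans back (cong (col-b⁻ ∘ runTile n) (sym next-offset))
    }
    where
    beside : ∀ k {b} → toggled (o + k) ≡ b → toggle h p (l + o + k) ≡ b
    beside k eq = trans (cong (toggle h p) (ℤ.+-assoc l o k)) (trans (toggled-at-offset (o + k)) eq)

  as-unlit : (∀ o → toggled o ≡ false)
           → col-b (runTile n d) ≡ cd → cb ≡ col-b⁻ (runTile n (+ 1 + d))
           → Toggled (run l n h≗run) p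
  as-unlit dark forth back = record
    { shape = unlit λ x → trans (toggled-at x) (dark (x - l))
    ; forth = trans (cong (col-b ∘ runTile n) p-l≡d) forth
    ; back  = trans back (cong (col-b⁻ ∘ runTile n) (sym next-offset))
    }

data Placement : ℕ → ℕ → Set where
  at-end    : ∀ k → Placement k (suc k)
  inside    : ∀ k j → Placement k (suc (suc (k ℕ.+ j)))
  just-past : ∀ k → Placement k k
  beyond    : ∀ n j → Placement (suc (n ℕ.+ j)) n

placement : ∀ k n → Placement k n
placement zero    zero          = just-past 0
placement zero    (suc zero)    = at-end 0
placement zero    (suc (suc j)) = inside 0 j
placement (suc k) zero          = beyond 0 k
placement (suc k) (suc n) with placement k n
... | at-end .k    = at-end (suc k)
... | inside .k j  = inside (suc k) j
... | just-past .k = just-past (suc k)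
... | beyond .n j  = beyond (suc n) j

+≢+ : ∀ {m k} → m < k → + m ≢ + k
+≢+ m<k eq = ℕ.<⇒≢ m<k (ℤ.+-injective eq)

toggle-before-start : ∀ {h l n} (h≗run : h ≗ interval l (suc n)) p → p - l ≡ -[1+ 0 ] → Toggled (run l n h≗run) p
toggle-before-start {n = n} h≗run p p-l≡d = as-run (+ 1) (suc n) grown refl refl
  where
  open ToggleRun h≗run p _ p-l≡d
  grown : ∀ o → range (suc n) o xor (-[1+ 0 ] == o) ≡ range (suc (suc n)) (+ 1 + o)
  grown (+ k)        = xor-identityʳ _
  grown -[1+ zero ]  = refl
  grown -[1+ suc k ] = refl

toggle-far-before : ∀ {h l n} (h≗run : h ≗ interval l (suc n)) p k → p - l ≡ -[1+ suc k ]
                  → Toggled (run l n h≗run) p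
toggle-far-before h≗run p k p-l≡d =
  as-gap d 0 k (==-refl d) (==-≢ {d} { -[1+ k ]} (ℕ.1+n≢n ∘ ℤ.-[1+-injective))
    (subst (λ o → toggled o ≡ true) (sym (ℤ.+-inverseˡ (+ suc (suc k)))) refl) refl refl
  where
  d = -[1+ suc k ]
  open ToggleRun h≗run p d p-l≡d

toggle-only-lamp : ∀ {h l} (h≗run : h ≗ interval l 1) p → p - l ≡ + 0 → Toggled (run l 0 h≗run) p
toggle-only-lamp h≗run p p-l≡d = as-unlit vanished refl refl
  where
  open ToggleRun h≗run p _ p-l≡d
  vanished : ∀ o → range 1 o xor (+ 0 == o) ≡ false
  vanished (+ zero) = refl
  vanished +[1+ k ] = refl
  vanished -[1+ k ] = refl

toggle-first-lamp : ∀ {h l n} (h≗run : h ≗ interval l (suc (suc n))) p → p - l ≡ + 0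
                  → Toggled (run l (suc n) h≗run) p
toggle-first-lamp {n = n} h≗run p p-l≡d = as-run -[1+ 0 ] n shrunk refl refl
  where
  open ToggleRun h≗run p _ p-l≡d
  shrunk : ∀ o → range (suc (suc n)) o xor (+ 0 == o) ≡ range (suc n) (-[1+ 0 ] + o)
  shrunk (+ zero) = refl
  shrunk +[1+ k ] = xor-identityʳ _
  shrunk -[1+ k ] = refl

toggle-last-lamp : ∀ {h l k} (h≗run : h ≗ interval l (suc (suc k))) p → p - l ≡ +[1+ k ]
                 → Toggled (run l (suc k) h≗run) p
toggle-last-lamp {k = k} h≗run p p-l≡d = as-run (+ 0) k shortened
  (trans (cong col-b (tileAfter-< (ℕ.n<1+n k))) (sym (cong col-b⁻ (tileAfter-> (ℕ.n<1+n k)))))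
  (trans (cong col-b (tileAfter-≡ k)) (sym (cong col-b⁻ (tileAfter-≡ k))))
  where
  open ToggleRun h≗run p _ p-l≡d
  shortened : ∀ o → range (suc (suc k)) o xor (+[1+ k ] == o) ≡ range (suc k) (+ 0 + o)
  shortened o = begin
    range (suc (suc k)) o xor (+[1+ k ] == o)                 ≡⟨ cong (_xor (+[1+ k ] == o)) (range-suc (suc k) o) ⟩
    ((+[1+ k ] == o) xor range (suc k) o) xor (+[1+ k ] == o) ≡⟨ cong (_xor (+[1+ k ] == o)) (xor-comm (+[1+ k ] == o) _) ⟩
    toggle (toggle (range (suc k)) +[1+ k ]) +[1+ k ] o       ≡⟨ toggle-involutive (range (suc k)) +[1+ k ] o ⟩
    range (suc k) o                                           ≡⟨ cong (range (suc k)) (sym (ℤ.+-identityˡ o)) ⟩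
    range (suc k) (+ 0 + o)                                   ∎
    where open ≡-Reasoning

toggle-inner-lamp : ∀ {h l k j} (h≗run : h ≗ interval l (suc (suc (suc (k ℕ.+ j))))) p → p - l ≡ +[1+ k ]
                  → Toggled (run l (suc (suc (k ℕ.+ j))) h≗run) p
toggle-inner-lamp {k = k} {j} h≗run p p-l≡d = as-gap (+ 0) k j refl
  (cong₂ _xor_ (range-<⇒true (s≤s k<n)) (==-refl +[1+ k ]))
  (cong₂ _xor_ (range-<⇒true (s≤s (ℕ.≤-reflexive far))) (==-≢ (+≢+ (ℕ.m<m+n (suc k) ℕ.z<s))))
  (cong col-b (tileAfter-< k<n)) (sym (cong col-b⁻ (tileAfter-< (s≤s (s≤s (ℕ.m≤m+n k j))))))
  where
  open ToggleRun h≗run p _ p-l≡d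
  k<n : k < suc (suc (k ℕ.+ j))
  k<n = ℕ.m<n⇒m<1+n (s≤s (ℕ.m≤m+n k j))
  far : suc k ℕ.+ suc j ≡ suc (suc (k ℕ.+ j))
  far = cong suc (ℕ.+-suc k j)

toggle-just-past : ∀ {h l k} (h≗run : h ≗ interval l (suc k)) p → p - l ≡ +[1+ k ]
                 → Toggled (run l k h≗run) p
toggle-just-past {k = k} h≗run p p-l≡d = as-run (+ 0) (suc k) extended
  (trans (cong col-b (tileAfter-≡ k)) (sym (cong col-b⁻ (tileAfter-≡ k))))
  (trans (cong col-b (tileAfter-< (ℕ.n<1+n k))) (sym (cong col-b⁻ (tileAfter-> (ℕ.n<1+n k)))))
  where
  open ToggleRun h≗run p _ p-l≡d
  extended : ∀ o → range (suc k) o xor (+[1+ k ] == o) ≡ range (suc (suc k)) (+ 0 + o)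
  extended o = begin
    range (suc k) o xor (+[1+ k ] == o)  ≡⟨ xor-comm (range (suc k) o) _ ⟩
    (+[1+ k ] == o) xor range (suc k) o  ≡⟨ sym (range-suc (suc k) o) ⟩
    range (suc (suc k)) o                ≡⟨ cong (range (suc (suc k))) (sym (ℤ.+-identityˡ o)) ⟩
    range (suc (suc k)) (+ 0 + o)        ∎
    where open ≡-Reasoning

toggle-far-past : ∀ {h l n j} (h≗run : h ≗ interval l (suc n)) p → p - l ≡ +[1+ suc (n ℕ.+ j) ]
                → Toggled (run l n h≗run) p
toggle-far-past {n = n} {j} h≗run p p-l≡d = as-gap (+ n) 0 j
  (cong₂ _xor_ (range-<⇒true (ℕ.n<1+n n)) (==-≢ (≢-sym (+≢+ n<K))))
  (subst (λ o → toggled o ≡ false) (cong +_ (ℕ.+-comm 1 n))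
    (cong₂ _xor_ (range-≥⇒false {suc n} ℕ.≤-refl) (==-≢ (≢-sym (+≢+ (s≤s (s≤s (ℕ.m≤m+n n j))))))))
  (subst (λ o → toggled o ≡ true) (cong +_ (sym far))
    (cong₂ _xor_ (range-≥⇒false {suc n} n<K) (==-refl (+ K))))
  (cong col-b (tileAfter-> (s≤s (ℕ.m≤m+n n j)))) (sym (cong col-b⁻ (tileAfter-> n<K)))
  where
  K = suc (suc (n ℕ.+ j))
  open ToggleRun h≗run p _ p-l≡d
  n<K : n < K
  n<K = ℕ.m<n⇒m<1+n (s≤s (ℕ.m≤m+n n j))
  far : n ℕ.+ suc (suc j) ≡ K
  far = trans (ℕ.+-suc n (suc j)) (cong suc (ℕ.+-suc n j))

toggle-run-at : ∀ {h l n} (h≗run : h ≗ interval l (suc n)) p d → p - l ≡ d → Toggled (run l n h≗run) p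
toggle-run-at            h≗run p -[1+ zero ] = toggle-before-start h≗run p
toggle-run-at            h≗run p -[1+ suc k ] = toggle-far-before h≗run p k
toggle-run-at {n = zero}  h≗run p (+ zero) = toggle-only-lamp h≗run p
toggle-run-at {n = suc n} h≗run p (+ zero) = toggle-first-lamp h≗run p
toggle-run-at {n = n}     h≗run p +[1+ k ] with placement k n
... | at-end .k    = toggle-last-lamp h≗run p
... | inside .k j  = toggle-inner-lamp h≗run p
... | just-past .k = toggle-just-past h≗run p
... | beyond .n j  = toggle-far-past h≗run p

toggle-run : ∀ {h l n} (h≗run : h ≗ interval l (suc n)) p → Toggled (run l n h≗run) p
toggle-run {l = l} h≗run p = toggle-run-at h≗run p (p - l) refl

switch-off : (ℤ → Bool) → ℤ → ℤ → Bool
switch-off f lo x = if lo == x then false else f x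

Window : (ℤ → Bool) → ℤ → ℕ → Set
Window f lo N = ∀ x → f x ≡ true → ∃[ k ] x ≡ lo + + k × k < N

lo≢lo+1+k : ∀ lo k → lo ≢ lo + + 1 + + k
lo≢lo+1+k lo k eq = 0≢1+k (trans (sym (ℤ.+-inverseʳ lo)) (trans (cong (_- lo) eq) (cancel lo (+ k))))
  where
  cancel : ∀ lo k → lo + + 1 + k - lo ≡ + 1 + k
  cancel = solve-∀
  0≢1+k : + 0 ≢ +[1+ k ]
  0≢1+k ()

window-switch-off : ∀ {f lo N} → Window f lo (suc N) → Window (switch-off f lo) (lo + + 1) N
window-switch-off {f} {lo} win x lit with lo ℤ.≟ x
... | no lo≢x with win x lit
...   | zero  , x≡lo+0 , _       = ⊥-elim (lo≢x (sym (trans x≡lo+0 (ℤ.+-identityʳ lo))))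
...   | suc k , x≡lo+k , s≤s k<N = k , trans x≡lo+k (sym (ℤ.+-assoc lo (+ 1) (+ k))) , k<N

switch-off-dark : ∀ {f lo} → f lo ≡ false → switch-off f lo ≗ f
switch-off-dark {f} {lo} f-lo x with lo ℤ.≟ x
... | yes refl = sym f-lo
... | no _     = refl

switch-off-lit : ∀ {f lo} → f lo ≡ true → toggle (switch-off f lo) lo ≗ f
switch-off-lit {f} {lo} f-lo x with lo ℤ.≟ x
... | yes refl = sym f-lo
... | no _     = xor-identityʳ (f x)

toggle-gap-below : ∀ {h lo N} → Window h (lo + + 1) N → ∀ x i j → h x ≡ true → h (x + +[1+ i ]) ≡ false
                 → h (x + + (suc i ℕ.+ suc j)) ≡ true → Shape (toggle h lo)
toggle-gap-below {h} {lo} win x i j on off on′ with win x on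
... | k , x≡lo+1+k , _ =
  gap x i j (subst (λ y → toggle h lo y ≡ true) (ℤ.+-identityʳ x) (kept 0 (trans (cong h (ℤ.+-identityʳ x)) on)))
    (kept (suc i) off) (kept (suc i ℕ.+ suc j) on′)
  where
  clear : ∀ m → (lo == x + + m) ≡ false
  clear m = ==-≢ λ eq → lo≢lo+1+k lo (k ℕ.+ m)
    (trans eq (trans (cong (_+ + m) x≡lo+1+k) (ℤ.+-assoc (lo + + 1) (+ k) (+ m))))
  kept : ∀ m {b} → h (x + + m) ≡ b → toggle h lo (x + + m) ≡ b
  kept m eq = trans (cong (h (x + + m) xor_) (clear m)) (trans (xor-identityʳ _) eq)

-- Lamps above lo are classified first; switching on lo, below all of them, cannot close a gap.
shape-in-window : ∀ N {f lo} → Window f lo N → Shape f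
shape-in-window zero {f} win = unlit dark
  where
  dark : ∀ x → f x ≡ false
  dark x with f x in lit
  ... | false = refl
  ... | true with win x lit
  ...   | _ , _ , ()
shape-in-window (suc N) {f} {lo} win with f lo in f-lo | shape-in-window N {lo = lo + + 1} (window-switch-off {f} {lo} win)
... | false | C                    = shape-cast (switch-off-dark {f} {lo} f-lo) C
... | true  | unlit dark           = shape-cast (switch-off-lit {f} {lo} f-lo) (Toggled.shape (toggle-unlit dark lo))
... | true  | run l n h≗run        = shape-cast (switch-off-lit {f} {lo} f-lo) (Toggled.shape (toggle-run h≗run lo))
... | true  | gap x i j on off on′ = shape-cast (switch-off-lit {f} {lo} f-lo)
  (toggle-gap-below {switch-off f lo} {lo} (window-switch-off {f} {lo} win) x i j on off on′)

spread : List ℤ → ℕ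
spread c = sum (map ∣_∣ c)

lamp-lit⇒∣∣≤spread : ∀ c x → lamp c x ≡ true → ∣ x ∣ ≤ spread c
lamp-lit⇒∣∣≤spread (y ∷ c) x lit with y ℤ.≟ x
... | yes refl = ℕ.m≤m+n ∣ y ∣ (spread c)
... | no _     = ℕ.≤-trans (lamp-lit⇒∣∣≤spread c x lit) (ℕ.m≤n+m (spread c) ∣ y ∣)

∣∣≤⇒shift : ∀ x B → ∣ x ∣ ≤ B → ∃[ k ] x + + B ≡ + k × k < suc (B ℕ.+ B)
∣∣≤⇒shift (+ u)    B u≤B   = u ℕ.+ B , refl , s≤s (ℕ.+-monoˡ-≤ B u≤B)
∣∣≤⇒shift -[1+ u ] B 1+u≤B = B ℕ.∸ suc u , ℤ.⊖-≥ 1+u≤B , s≤s (ℕ.≤-trans (ℕ.m∸n≤m B (suc u)) (ℕ.m≤m+n B B))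

lamp-window : ∀ c → Window (lamp c) (- + spread c) (suc (spread c ℕ.+ spread c))
lamp-window c x lit with ∣∣≤⇒shift x (spread c) (lamp-lit⇒∣∣≤spread c x lit)
... | k , x+B≡k , k<N = k , trans (sym (undo x (+ spread c))) (cong (λ y → - + spread c + y) x+B≡k) , k<N
  where
  undo : ∀ x B → - B + (x + B) ≡ x
  undo = solve-∀

shape : ∀ g → Shape (lamps g)
shape g = shape-in-window _ {lo = - + spread (cfg g)} (lamp-window (cfg g))

-- The comb tiling

comb : L → Πc
comb g = tile (shape g) (pos g)

comb-at : ∀ g (C : Shape (lamps g)) → comb g ≡ tile C (pos g)
comb-at g C = tile-unique (shape g) C (λ _ → refl) (pos g)

comb-resp : ∀ g h → g ≈ h → comb g ≡ comb h
comb-resp g h (same-pos , same-lamps) =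
  trans (tile-unique (shape g) (shape h) same-lamps (pos g)) (cong (tile (shape h)) same-pos)

comb-a-edge : ∀ g → col-a (comb g) ≡ col-a⁻ (comb (g · a))
comb-a-edge g = trans (tile-a-edge (shape g) (pos g))
  (cong col-a⁻ (tile-unique (shape g) (shape (g · a)) (λ i → sym (lamps-·a g i)) (pos g + + 1)))

b-edge-forth : ∀ g {C : Shape (lamps g)} (D : Shape (lamps (g · b))) → Toggled C (pos g)
             → col-b (tile C (pos g)) ≡ col-b⁻ (tile D (pos g + + 1))
b-edge-forth g D T =
  trans (Toggled.forth T) (cong col-b⁻ (tile-unique (Toggled.shape T) D (λ i → sym (lamps-·b g i)) (pos g + + 1)))

b-edge-back : ∀ g (C : Shape (lamps g)) {D : Shape (lamps (g · b))} → Toggled D (pos g)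
            → col-b (tile C (pos g)) ≡ col-b⁻ (tile D (pos g + + 1))
b-edge-back g C T = trans (cong col-b (tile-unique C (Toggled.shape T) toggled-back (pos g))) (Toggled.back T)
  where
  toggled-back : lamps g ≗ toggle (lamps (g · b)) (pos g)
  toggled-back i = sym (trans (cong (_xor (pos g == i)) (lamps-·b g i)) (toggle-involutive (lamps g) (pos g) i))

-- A gapped shape cannot be toggled in general, so an edge into an ungapped shape is read backwards.
b-edge-between : ∀ g (C : Shape (lamps g)) (D : Shape (lamps (g · b)))
               → col-b (tile C (pos g)) ≡ col-b⁻ (tile D (pos g + + 1))
b-edge-between g (unlit dark)         D             = b-edge-forth g D (toggle-unlit dark (pos g))
b-edge-between g (run l n h≗run)      D             = b-edge-forth g D (toggle-run h≗run (pos g))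
b-edge-between g C@(gap _ _ _ _ _ _)  (unlit dark)  = b-edge-back g C (toggle-unlit dark (pos g))
b-edge-between g C@(gap _ _ _ _ _ _)  (run l n h≗run) = b-edge-back g C (toggle-run h≗run (pos g))
b-edge-between g (gap _ _ _ _ _ _)    (gap _ _ _ _ _ _) = refl

comb-valid : IsValidTiling comb
comb-valid = comb-resp , comb-a-edge , λ g → b-edge-between g (shape g) (shape (g · b))

comb-·a^ : ∀ g z (C : Shape (lamps g)) → comb (g · (a ^ z)) ≡ tile C (pos g + z)
comb-·a^ g z C = trans (tile-unique (shape (g · (a ^ z))) C (lamps-·a^ g z) (pos (g · (a ^ z))))
                       (cong (λ x → tile C (pos g + x)) (pos-a^ z))

comb-·a^0 : ∀ g → comb g ≡ comb (g · (a ^ (+ 0)))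
comb-·a^0 g = comb-resp g (g · (a ^ (+ 0))) (≈-sym {g · (a ^ (+ 0))} {g} (·a^0-≈ g))

comb-a^b^+a^ : ∀ n m z → comb (((a ^ n) · (b ^ +[1+ m ])) · (a ^ z)) ≡ runTile m (+[1+ m ] + z)
comb-a^b^+a^ n m z =
  trans (comb-·a^ ((a ^ n) · (b ^ +[1+ m ])) z (run n m (lamps-a^b^+ n (suc m))))
        (cong (runTile m) (trans (cong (λ x → x + z - n) (pos-a^b^ n +[1+ m ])) (cancel n +[1+ m ] z)))
  where
  cancel : ∀ n y z → n + y + z - n ≡ y + z
  cancel = solve-∀

comb-a^b^-a^ : ∀ n m z → comb (((a ^ n) · (b ^ -[1+ m ])) · (a ^ z)) ≡ runTile m z
comb-a^b^-a^ n m z =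
  trans (comb-·a^ ((a ^ n) · (b ^ -[1+ m ])) z (run (n - + suc m) m (lamps-a^b^- n m)))
        (cong (runTile m) (trans (cong (λ x → x + z - (n - + suc m)) (pos-a^b^ n -[1+ m ])) (cancel n (+ suc m) z)))
  where
  cancel : ∀ n k z → n - k + z - (n - k) ≡ z
  cancel = solve-∀

comb-formulas : CombFormulas comb
comb-formulas =
    (λ n → comb-at (a ^ n) (unlit (lamps-a^ n)))
  , (λ { n (suc m) _ → trans (comb-·a^0 ((a ^ n) · (b ^ +[1+ m ])))
                         (trans (comb-a^b^+a^ n m (+ 0)) (trans (cong (runTile m) (ℤ.+-identityʳ +[1+ m ])) (tileAfter-≡ m))) })
  , (λ { n (suc m) _ → trans (comb-·a^0 ((a ^ n) · (b ^ -[1+ m ])))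
                         (comb-a^b^-a^ n m (+ 0)) })
  , (λ { n m (suc k) _ k<m → inside-arm n m k k<m })
  , (λ { n (suc m) (suc k) _ _ → comb-a^b^-a^ n m -[1+ k ] })
  , (λ { n (suc m) (suc k) _ _ → trans (comb-a^b^+a^ n m +[1+ k ]) (tileAfter-> (ℕ.m<m+n m ℕ.z<s)) })
  where
  inside-arm : ∀ n m k → suc k < m → comb (((a ^ n) · (b ^ (+ m))) · (a ^ -[1+ k ])) ≡ Ts
  inside-arm n m k k+1<m with ℕ.m≤n⇒∃[o]m+o≡n k+1<m
  ... | o , refl = trans (comb-a^b^+a^ n (suc (k ℕ.+ o)) -[1+ k ])
                         (trans (cong (runTile (suc (k ℕ.+ o))) offset) (tileAfter-< (s≤s (ℕ.m≤n+m o k))))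
    where
    cancel : ∀ u v → u + v + - u ≡ v
    cancel = solve-∀
    offset : +[1+ suc (k ℕ.+ o) ] + -[1+ k ] ≡ +[1+ o ]
    offset = trans (cong (λ x → + suc x + -[1+ k ]) (sym (ℕ.+-suc k o))) (cancel (+ suc k) (+ suc o))

InZ-intro : ∀ n m k g → pos ((a ^ n) · (b ^ m)) + k ≡ pos g → lamps ((a ^ n) · (b ^ m)) ≗ lamps g → InZ g
InZ-intro n m k g same-pos same-lamps =
  n , m , k , ≈-sym {((a ^ n) · (b ^ m)) · (a ^ k)} {g} (·a^-≈ ((a ^ n) · (b ^ m)) k g same-pos same-lamps)

comb-off-Z : ∀ g → ¬ InZ g → comb g ≡ Tt
comb-off-Z g g∉Z with shape g
... | unlit dark = ⊥-elim (g∉Z (InZ-intro (pos g) (+ 0) (+ 0) g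
        (trans (ℤ.+-identityʳ _) (trans (pos-a^b^ (pos g) (+ 0)) (ℤ.+-identityʳ (pos g))))
        (λ i → trans (lamps-a^· (pos g) (b ^ (+ 0)) i) (sym (dark i)))))
... | run l n h≗run = ⊥-elim (g∉Z (InZ-intro l (+ suc n) (pos g - (l + + suc n)) g
        (trans (cong (λ x → x + (pos g - (l + + suc n))) (pos-a^b^ l (+ suc n))) (cancel (l + + suc n) (pos g)))
        (λ i → trans (lamps-a^b^+ l (suc n) i) (sym (h≗run i)))))
  where
  cancel : ∀ y p → y + (p - y) ≡ p
  cancel = solve-∀
... | gap _ _ _ _ _ _ = refl

lemma5p1 : ((η : L → Πc) → IsValidTiling η → η e ≡ TA → CombFormulas η)
             × Σ (L → Πc) (λ η → IsValidTiling η × CombFormulas η × ((g : L) → ¬ InZ g → η g ≡ Tt))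
lemma5p1 = forward , comb , comb-valid , comb-formulas , comb-off-Z
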